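{- Let $a\ge 3$ be an integer. For every positive integer $N\ge 3a\binom{a}{2}+2a(a-1)$ there exist nonnegative integers $x,y,z$ with $$N=x\binom{a}{2}+y\binom{a+1}{2}+z\binom{a+2}{2}.$$ Consequently, for every positive integer $N\ge 2a^3+2a^2+1$ there exist positive integers $x,y,z$ with $$N=\left(\binom{a}{3}+x\binom{a}{2}\right)+\left(\binom{a+1}{3}+y\binom{a+1}{2}\right)+\left(\binom{a+2}{3}+z\binom{a+2}{2}\right).$$ -}

{-# OPTIONS --safe #-}
-- Write A = a C 2, so that (a + 1) C 2 = A + a and (a + 2) C 2 = A + 2a + 1.  Dividing N by A
-- and the remainder by a gives N = sA + qa + r with q, r < a (q < a because A < a²).  Putting
-- f = a - 1 - r, one may take x = s - q - 2a - 2 + r, y = q + 2f, z = r: the linear parts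
-- contribute qa + r + 2a(a - 1) = qa + r + 4A, and N ≥ (3a + 4)A makes x nonnegative.
-- The second claim is the first one applied to N minus the three (a + i) C 3 and one copy of
-- each (a + i) C 2; these and the first threshold add up to exactly 2a³ + 2a² + 1.
module Submission where

open import Data.List using (_∷_; [])
open import Data.Nat
open import Data.Nat.Combinatorics using (_C_; nC1≡n; nCk+nC[k+1]≡[n+1]C[k+1])
open import Data.Nat.DivMod
open import Data.Nat.Properties
open import Data.Nat.Tactic.RingSolver using (solve)
open import Data.Product using (_×_; _,_; ∃-syntax)
open import Relation.Binary.PropositionalEquality

[1+n]C2≡n+nC2 : ∀ n → suc n C 2 ≡ n + n C 2
[1+n]C2≡n+nC2 n = trans (sym (nCk+nC[k+1]≡[n+1]C[k+1] n 1)) (cong (_+ n C 2) (nC1≡n n))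

[n+1]C2≡n+nC2 : ∀ n → (n + 1) C 2 ≡ n + n C 2
[n+1]C2≡n+nC2 n = trans (cong (_C 2) (+-comm n 1)) ([1+n]C2≡n+nC2 n)

[n+1]C3≡nC2+nC3 : ∀ n → (n + 1) C 3 ≡ n C 2 + n C 3
[n+1]C3≡nC2+nC3 n = trans (cong (_C 3) (+-comm n 1)) (sym (nCk+nC[k+1]≡[n+1]C[k+1] n 2))

[n+2]C2≡n+1+[n+1]C2 : ∀ n → (n + 2) C 2 ≡ n + 1 + (n + 1) C 2
[n+2]C2≡n+1+[n+1]C2 n = trans (cong (_C 2) (sym (+-assoc n 1 1))) ([n+1]C2≡n+nC2 (n + 1))

[n+2]C3≡[n+1]C2+[n+1]C3 : ∀ n → (n + 2) C 3 ≡ (n + 1) C 2 + (n + 1) C 3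
[n+2]C3≡[n+1]C2+[n+1]C3 n = trans (cong (_C 3) (sym (+-assoc n 1 1))) ([n+1]C3≡nC2+nC3 (n + 1))

2*[1+n]C2≡[1+n]*n : ∀ n → 2 * (suc n C 2) ≡ suc n * n
2*[1+n]C2≡[1+n]*n zero    = refl
2*[1+n]C2≡[1+n]*n (suc n) = begin
  2 * (suc (suc n) C 2)        ≡⟨ cong (2 *_) ([1+n]C2≡n+nC2 (suc n)) ⟩
  2 * (suc n + suc n C 2)      ≡⟨ *-distribˡ-+ 2 (suc n) (suc n C 2) ⟩
  2 * suc n + 2 * (suc n C 2)  ≡⟨ cong (2 * suc n +_) (2*[1+n]C2≡[1+n]*n n) ⟩
  2 * suc n + suc n * n        ≡⟨ solve (n ∷ []) ⟩
  suc (suc n) * suc n          ∎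
  where open ≡-Reasoning

6*[2+n]C3≡[2+n]*[1+n]*n : ∀ n → 6 * (suc (suc n) C 3) ≡ suc (suc n) * suc n * n
6*[2+n]C3≡[2+n]*[1+n]*n zero    = refl
6*[2+n]C3≡[2+n]*[1+n]*n (suc n) = begin
  6 * (suc (suc (suc n)) C 3)
    ≡⟨ cong (6 *_) (nCk+nC[k+1]≡[n+1]C[k+1] (suc (suc n)) 2) ⟨
  6 * (suc (suc n) C 2 + suc (suc n) C 3)
    ≡⟨ *-distribˡ-+ 6 (suc (suc n) C 2) (suc (suc n) C 3) ⟩
  6 * (suc (suc n) C 2) + 6 * (suc (suc n) C 3)
    ≡⟨ cong (_+ 6 * (suc (suc n) C 3)) (*-assoc 3 2 (suc (suc n) C 2)) ⟩
  3 * (2 * (suc (suc n) C 2)) + 6 * (suc (suc n) C 3)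
    ≡⟨ cong₂ (λ u v → 3 * u + v) (2*[1+n]C2≡[1+n]*n (suc n)) (6*[2+n]C3≡[2+n]*[1+n]*n n) ⟩
  3 * (suc (suc n) * suc n) + suc (suc n) * suc n * n
    ≡⟨ solve (n ∷ []) ⟩
  suc (suc (suc n)) * suc (suc n) * suc n
    ∎
  where open ≡-Reasoning

2*m≡1+n⇒NonZero : ∀ {m n} → 2 * m ≡ suc n → NonZero m
2*m≡1+n⇒NonZero {zero}  ()
2*m≡1+n⇒NonZero {suc m} _ = _

Representable : ℕ → ℕ → ℕ → ℕ → Set
Representable A B C′ N = ∃[ x ] ∃[ y ] ∃[ z ] N ≡ x * A + y * B + z * C′

remainder-absorption : ∀ {m A} → 2 * A ≡ suc m * m → ∀ {r f} → r + f ≡ m → ∀ q e →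
  (q + 2 * suc m + 2 + e) * A + (r + q * suc m)
    ≡ (e + r) * A + (q + 2 * f) * (suc m + A) + r * (suc m + 1 + (suc m + A))
remainder-absorption {A = A} 2A≡[1+m]m {r} {f} refl q e = begin
  (q + 2 * suc (r + f) + 2 + e) * A + (r + q * suc (r + f))
    ≡⟨ solve (A ∷ r ∷ f ∷ q ∷ e ∷ []) ⟩
  (e + q + 2 * (r + f)) * A + (r + q * suc (r + f)) + 2 * (2 * A)
    ≡⟨ cong (λ t → (e + q + 2 * (r + f)) * A + (r + q * suc (r + f)) + 2 * t) 2A≡[1+m]m ⟩
  (e + q + 2 * (r + f)) * A + (r + q * suc (r + f)) + 2 * (suc (r + f) * (r + f))
    ≡⟨ solve (A ∷ r ∷ f ∷ q ∷ e ∷ []) ⟩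
  (e + r) * A + (q + 2 * f) * (suc (r + f) + A) + r * (suc (r + f) + 1 + (suc (r + f) + A))
    ∎
  where open ≡-Reasoning

representable-by-division : ∀ {m A s q r} → 2 * A ≡ suc m * m → r ≤ m → q + 2 * suc m + 2 ≤ s →
  Representable A (suc m + A) (suc m + 1 + (suc m + A)) (s * A + (r + q * suc m))
representable-by-division {q = q} {r} 2A≡[1+m]m r≤m q+2a+2≤s
  with m≤n⇒∃[o]m+o≡n r≤m | m≤n⇒∃[o]m+o≡n q+2a+2≤s
... | f , r+f≡m | e , refl = e + r , q + 2 * f , r , remainder-absorption 2A≡[1+m]m r+f≡m q e

triangular-representation : ∀ {m A B C′} .{{_ : NonZero A}} → 2 * A ≡ suc m * m →
  B ≡ suc m + A → C′ ≡ suc m + 1 + B →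
  ∀ N → 3 * suc m * A + 2 * suc m * m ≤ N → Representable A B C′ N
triangular-representation {m} {A} 2A≡[1+m]m refl refl N bound =
  subst (Representable A _ _) (sym N≡sA+[r+qa])
    (representable-by-division 2A≡[1+m]m (m<1+n⇒m≤n (m%n<n R a)) q+2a+2≤s)
  where
  a s R q r : ℕ
  a = suc m
  s = N / A
  R = N % A
  q = R / a
  r = R % a

  N≡sA+[r+qa] : N ≡ s * A + (r + q * a)
  N≡sA+[r+qa] = begin
    N                  ≡⟨ m≡m%n+[m/n]*n N A ⟩
    R + s * A          ≡⟨ +-comm R (s * A) ⟩
    s * A + R          ≡⟨ cong (s * A +_) (m≡m%n+[m/n]*n R a) ⟩
    s * A + (r + q * a) ∎
    where open ≡-Reasoning

  q<a : q < a
  q<a = m<n*o⇒m/o<n (begin-strict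
    R          <⟨ m%n<n N A ⟩
    A          ≤⟨ m≤m+n A (A + 0) ⟩
    2 * A      ≡⟨ 2A≡[1+m]m ⟩
    a * m      ≤⟨ *-monoʳ-≤ a (n≤1+n m) ⟩
    a * a      ∎)
    where open ≤-Reasoning

  bound≡[3a+4]A : 3 * suc m * A + 2 * suc m * m ≡ (3 * suc m + 4) * A
  bound≡[3a+4]A = begin
    3 * suc m * A + 2 * suc m * m    ≡⟨ solve (m ∷ A ∷ []) ⟩
    3 * suc m * A + 2 * (suc m * m)  ≡⟨ cong (λ t → 3 * suc m * A + 2 * t) 2A≡[1+m]m ⟨
    3 * suc m * A + 2 * (2 * A)      ≡⟨ solve (m ∷ A ∷ []) ⟩
    (3 * suc m + 4) * A              ∎
    where open ≡-Reasoning

  q+2a+2≤s : q + 2 * a + 2 ≤ s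
  q+2a+2≤s = begin
    q + 2 * a + 2          ≤⟨ +-monoˡ-≤ 2 (+-monoˡ-≤ (2 * a) (<⇒≤ q<a)) ⟩
    3 * a + 2              ≤⟨ +-monoʳ-≤ (3 * a) (s≤s (s≤s z≤n)) ⟩
    3 * a + 4              ≡⟨ m*n/n≡m (3 * a + 4) A ⟨
    (3 * a + 4) * A / A    ≤⟨ /-monoˡ-≤ A (subst (_≤ N) bound≡[3a+4]A bound) ⟩
    s                      ∎
    where open ≤-Reasoning

representable-shift : ∀ {A B C′ L} D₀ D₁ D₂ → (∀ N → L ≤ N → Representable A B C′ N) →
  ∀ N → D₀ + D₁ + D₂ + A + B + C′ + L ≤ N →
  ∃[ x ] ∃[ y ] ∃[ z ] (0 < x × 0 < y × 0 < z × N ≡ (D₀ + x * A) + (D₁ + y * B) + (D₂ + z * C′))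
representable-shift {A} {B} {C′} {L} D₀ D₁ D₂ representable N bound
  with m≤n⇒∃[o]m+o≡n bound
... | e , refl with representable (L + e) (m≤m+n L e)
... | x , y , z , L+e≡ = suc x , suc y , suc z , z<s , z<s , z<s , (begin
  D₀ + D₁ + D₂ + A + B + C′ + L + e
    ≡⟨ +-assoc (D₀ + D₁ + D₂ + A + B + C′) L e ⟩
  D₀ + D₁ + D₂ + A + B + C′ + (L + e)
    ≡⟨ cong (D₀ + D₁ + D₂ + A + B + C′ +_) L+e≡ ⟩
  D₀ + D₁ + D₂ + A + B + C′ + (x * A + y * B + z * C′)
    ≡⟨ solve (D₀ ∷ D₁ ∷ D₂ ∷ A ∷ B ∷ C′ ∷ x ∷ y ∷ z ∷ []) ⟩
  (D₀ + suc x * A) + (D₁ + suc y * B) + (D₂ + suc z * C′)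
    ∎)
  where open ≡-Reasoning

-- The ring solver treats local definitions as constants, hence suc (suc n) is spelled out below.
threshold-identity : ∀ n {A B C′ D₀ D₁ D₂} → let a = suc (suc n) in
  2 * A ≡ a * suc n → 6 * D₀ ≡ a * suc n * n →
  B ≡ a + A → C′ ≡ a + 1 + B → D₁ ≡ A + D₀ → D₂ ≡ B + D₁ →
  D₀ + D₁ + D₂ + A + B + C′ + (3 * a * A + 2 * a * suc n) ≡ 2 * a ^ 3 + 2 * a ^ 2 + 1
threshold-identity n {A} {D₀ = D₀} 2A≡ 6D₀≡ refl refl refl refl = *-cancelˡ-≡ _ _ 2 (begin
  2 * (D₀ + (A + D₀) + (suc (suc n) + A + (A + D₀)) + A + (suc (suc n) + A)
        + (suc (suc n) + 1 + (suc (suc n) + A)) + (3 * suc (suc n) * A + 2 * suc (suc n) * suc n))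
    ≡⟨ solve (n ∷ A ∷ D₀ ∷ []) ⟩
  6 * D₀ + (3 * suc (suc n) + 6) * (2 * A) + 4 * suc (suc n) * suc n + 8 * suc (suc n) + 2
    ≡⟨ cong₂ (λ u v → u + (3 * suc (suc n) + 6) * v + 4 * suc (suc n) * suc n + 8 * suc (suc n) + 2) 6D₀≡ 2A≡ ⟩
  suc (suc n) * suc n * n + (3 * suc (suc n) + 6) * (suc (suc n) * suc n)
    + 4 * suc (suc n) * suc n + 8 * suc (suc n) + 2
    ≡⟨ solve (n ∷ []) ⟩
  2 * (2 * (suc (suc n) * (suc (suc n) * (suc (suc n) * 1))) + 2 * (suc (suc n) * (suc (suc n) * 1)) + 1)
    ≡⟨⟩
  2 * (2 * suc (suc n) ^ 3 + 2 * suc (suc n) ^ 2 + 1)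
    ∎)
  where open ≡-Reasoning

lemma3p24 : (a : ℕ) → 3 ≤ a →
    ((N : ℕ) → 0 < N → 3 * a * (a C 2) + 2 * a * (a ∸ 1) ≤ N →
      ∃[ x ] ∃[ y ] ∃[ z ] N ≡ x * (a C 2) + y * ((a + 1) C 2) + z * ((a + 2) C 2))
    ×
    ((N : ℕ) → 0 < N → 2 * a ^ 3 + 2 * a ^ 2 + 1 ≤ N →
      ∃[ x ] ∃[ y ] ∃[ z ] (0 < x × 0 < y × 0 < z ×
        N ≡ ((a C 3) + x * (a C 2)) + (((a + 1) C 3) + y * ((a + 1) C 2)) + (((a + 2) C 3) + z * ((a + 2) C 2))))
lemma3p24 zero            ()
lemma3p24 (suc zero)      (s≤s ())
lemma3p24 a@(suc (suc n)) _ =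
  (λ N _ → representable N) ,
  (λ N _ bound → representable-shift (a C 3) ((a + 1) C 3) ((a + 2) C 3) representable N
    (≤-trans (≤-reflexive threshold) bound))
  where
  2A≡a[a-1] : 2 * (a C 2) ≡ a * suc n
  2A≡a[a-1] = 2*[1+n]C2≡[1+n]*n (suc n)

  instance
    A≢0 : NonZero (a C 2)
    A≢0 = 2*m≡1+n⇒NonZero 2A≡a[a-1]

  representable : ∀ N → 3 * a * (a C 2) + 2 * a * suc n ≤ N →
    Representable (a C 2) ((a + 1) C 2) ((a + 2) C 2) N
  representable = triangular-representation 2A≡a[a-1] ([n+1]C2≡n+nC2 a) ([n+2]C2≡n+1+[n+1]C2 a)

  threshold : a C 3 + (a + 1) C 3 + (a + 2) C 3 + a C 2 + (a + 1) C 2 + (a + 2) C 2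
                + (3 * a * (a C 2) + 2 * a * suc n) ≡ 2 * a ^ 3 + 2 * a ^ 2 + 1
  threshold = threshold-identity n 2A≡a[a-1] (6*[2+n]C3≡[2+n]*[1+n]*n n)
    ([n+1]C2≡n+nC2 a) ([n+2]C2≡n+1+[n+1]C2 a) ([n+1]C3≡nC2+nC3 a) ([n+2]C3≡[n+1]C2+[n+1]C3 a)
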